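{- Let $(W,S)$ be a simply-laced triangle-free Coxeter system and let ${\boldsymbol{\alpha}}$ and ${\boldsymbol{\beta}}$ be two braid equivalent links of rank $r\ge1$. Then ${\boldsymbol{\alpha}}={\boldsymbol{\beta}}$ if and only if ${\boldsymbol{\alpha}}_{\llbracket 2i\rrbracket}={\boldsymbol{\beta}}_{\llbracket 2i\rrbracket}$ for all $1\le i\le r$.
   Context: A Coxeter system $(W,S)$: finite $S$, $W=\langle S\mid (st)^{m(s,t)}=e\rangle$, $m(s,s)=1$, $m(s,t)\in\{2,3,\dots,\infty\}$ for $s\ne t$; simply laced: $m(s,t)\le3$; Coxeter graph $\Gamma$ on $S$ with edge $\{s,t\}$ iff $m(s,t)\ge3$; triangle free: no three-cycles in $\Gamma$. Reduced expression: minimal-length word for its element. Braid move: replace consecutive $sts$ by $tst$ with $m(s,t)=3$; braid equivalence and braid class $[{\boldsymbol{\alpha}}]$ via finite sequences of braid moves. For ${\boldsymbol{\alpha}}=s_{x_1}\cdots s_{x_m}$, ${\boldsymbol{\alpha}}_{\llbracket k\rrbracket}=s_{x_k}$ is the letter in position $k$. $\llbracket i,i+2\rrbracket$ is a braid shadow of ${\boldsymbol{\alpha}}$ if $s_{x_i}=s_{x_{i+2}}$ and $m(s_{x_i},s_{x_{i+1}})=3$; $\operatorname{bs}([{\boldsymbol{\alpha}}])$ is the set of braid shadows of all elements of $[{\boldsymbol{\alpha}}]$, $\operatorname{rank}({\boldsymbol{\alpha}})=|\operatorname{bs}([{\boldsymbol{\alpha}}])|$. A reduced expression with $m\ge1$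 letters is a link if $m=1$ or $m$ is odd and $\operatorname{bs}([{\boldsymbol{\alpha}}])=\{\llbracket1,3\rrbracket,\dots,\llbracket m-2,m\rrbracket\}$; a link of rank $r$ has $2r+1$ letters. -}

module Defs where

open import Data.Nat using (ℕ; zero; suc; _+_; _*_; _≤_)
open import Data.Fin using (Fin)
open import Data.List using (List; []; _∷_; _++_; length)
open import Data.List.Membership.Propositional using (_∈_)
open import Data.List.Relation.Unary.Unique.Propositional using (Unique)
open import Data.Maybe using (Maybe; just; nothing)
open import Data.Product using (Σ; _×_; ∃; ∃-syntax)
open import Data.Sum using (_⊎_)
open import Function.Bundles using (_⇔_)
open import Relation.Binary.PropositionalEquality using (_≡_; _≢_)
open import Relation.Binary.Construct.Closure.ReflexiveTransitive using (Star)

data ℕ∞ : Set where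
  fin : ℕ → ℕ∞
  ∞   : ℕ∞

data _≥∞_ : ℕ∞ → ℕ → Set where
  fin≥ : ∀ {m k} → k ≤ m → fin m ≥∞ k
  ∞≥   : ∀ {k} → ∞ ≥∞ k

record CoxeterSystem (n : ℕ) : Set where
  field
    m      : Fin n → Fin n → ℕ∞
    m-sym  : ∀ s t → m s t ≡ m t s
    m-diag : ∀ s → m s s ≡ fin 1
    m-off  : ∀ s t → s ≢ t → m s t ≥∞ 2

module _ {n : ℕ} (C : CoxeterSystem n) where
  open CoxeterSystem C

  Word : Set
  Word = List (Fin n)

  SimplyLaced : Set
  SimplyLaced = ∀ s t → ∃[ k ] (m s t ≡ fin k × k ≤ 3)

  Edge : Fin n → Fin n → Set
  Edge s t = m s t ≥∞ 3

  TriangleFree : Set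
  TriangleFree = ∀ s t u → s ≢ t → t ≢ u → s ≢ u →
                 Edge s t → Edge t u → Edge s u → Data.Empty.⊥
    where import Data.Empty

  alt : Fin n → Fin n → ℕ → Word
  alt s t zero = []
  alt s t (suc k) = s ∷ t ∷ alt s t k

  -- equality in W = ⟨ S ∣ (st)^{m(s,t)} = e ⟩: the congruence on words
  -- generated by u (st)^{m(s,t)} v ~ u v  (m(s,t) finite)
  data _≈W_ : Word → Word → Set where
    ≈refl  : ∀ {u} → u ≈W u
    ≈sym   : ∀ {u v} → u ≈W v → v ≈W u
    ≈trans : ∀ {u v w} → u ≈W v → v ≈W w → u ≈W w
    ≈rel   : ∀ u v s t k → m s t ≡ fin k → (u ++ alt s t k ++ v) ≈W (u ++ v)

  Reduced : Word → Set
  Reduced α = ∀ β → α ≈W β → length α ≤ length β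

  data BraidMove : Word → Word → Set where
    move : ∀ u v s t → m s t ≡ fin 3 →
           BraidMove (u ++ s ∷ t ∷ s ∷ [] ++ v) (u ++ t ∷ s ∷ t ∷ [] ++ v)

  _∼B_ : Word → Word → Set
  _∼B_ = Star BraidMove

  -- letter at 1-indexed position k
  letterAt : Word → ℕ → Maybe (Fin n)
  letterAt []       _             = nothing
  letterAt (x ∷ xs) zero          = nothing
  letterAt (x ∷ xs) (suc zero)    = just x
  letterAt (x ∷ xs) (suc (suc k)) = letterAt xs (suc k)

  -- ⟦i, i+2⟧ is a braid shadow of α  (represented by its start i)
  IsBraidShadow : Word → ℕ → Set
  IsBraidShadow α i = ∃[ a ] ∃[ b ]
    (letterAt α i ≡ just a × letterAt α (suc i) ≡ just b ×
     letterAt α (suc (suc i)) ≡ just a × m a b ≡ fin 3)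

  InBS : Word → ℕ → Set
  InBS α i = ∃[ β ] (α ∼B β × IsBraidShadow β i)

  -- rank(α) = |bs([α])| = r : bs([α]) is enumerated by a duplicate-free list of length r
  HasRank : Word → ℕ → Set
  HasRank α r = ∃[ l ] (Unique l × length l ≡ r × (∀ i → (i ∈ l) ⇔ InBS α i))

  Odd : ℕ → Set
  Odd k = ∃[ j ] (k ≡ suc (2 * j))

  IsLink : Word → Set
  IsLink α = Reduced α × 1 ≤ length α ×
    (length α ≡ 1 ⊎
     (Odd (length α) ×
      (∀ i → InBS α i ⇔ (Odd i × suc (suc i) ≤ length α))))

-- Along any chain of braid moves starting from a link, every move happens at an
-- odd position 2q+1, so it only permutes letters inside the windows
-- {2q, 2q+1, 2q+2} and {2q+2, 2q+3, 2q+4}.  Hence braid equivalent links have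
-- the same letter sets in every window {2j, 2j+1, 2j+2}.  If the even letters
-- agree as well, the letter at 2j+1 of α lies in the window j of β, and it cannot
-- sit at 2j or 2j+2 there: it would then repeat the neighbouring letter of α,
-- which is impossible in a reduced word.  Finally the rank of a link of length
-- 2k+1 is at least k, so the hypothesis covers every even position of α.
module Submission where

open import Defs
open import Data.Nat using (ℕ; zero; suc; _+_; _*_; _≤_; _<_; z≤n; s≤s; _≤?_)
open import Data.Nat.Properties
  using (suc-injective; *-comm; *-cancelʳ-≡; *-monoˡ-≤; ≤-trans; ≤-pred; ≰⇒>; n≤1+n; 1+n≰n; <⇒≱)
open import Data.Fin using (Fin; toℕ)
open import Data.Fin.Properties using (toℕ-injective; toℕ<n; injective⇒≤)
open import Data.List using (List; []; _∷_; _++_; length; lookup)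
open import Data.List.Properties using (length-++; length-++-sucʳ; length-++-≤ʳ)
open import Data.List.Membership.Propositional using (_∈_)
open import Data.List.Relation.Unary.Any using (index)
open import Data.List.Relation.Unary.Any.Properties using (lookup-index)
open import Data.Maybe using (Maybe; just; nothing)
open import Data.Product using (_×_; _,_; proj₁; proj₂; ∃₂; ∃-syntax)
open import Data.Sum using (_⊎_; inj₁; inj₂)
import Data.Sum as Sum
open import Data.Empty using (⊥; ⊥-elim)
open import Function using (_∘_; id)
open import Function.Bundles using (_⇔_; mk⇔; Equivalence)
open import Function.Definitions using (Injective)
open import Relation.Nullary using (¬_; yes; no)
open import Relation.Binary.PropositionalEquality using (_≡_; refl; sym; trans; cong; subst)
open import Relation.Binary.Construct.Closure.ReflexiveTransitive using (ε; _◅_; _◅◅_; reverse)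

∈-injection⇒≤ : ∀ {k} {A : Set} {xs : List A} (f : Fin k → A) →
                Injective _≡_ _≡_ f → (∀ i → f i ∈ xs) → k ≤ length xs
∈-injection⇒≤ {xs = xs} f f-injective f∈xs = injective⇒≤ index-injective
  where
  index-injective : Injective _≡_ _≡_ (index ∘ f∈xs)
  index-injective {i} {j} eq = f-injective
    (trans (lookup-index (f∈xs i)) (trans (cong (lookup xs) eq) (sym (lookup-index (f∈xs j)))))

parity : ∀ p → ∃[ j ] (p ≡ j * 2 ⊎ p ≡ 1 + j * 2)
parity zero = 0 , inj₁ refl
parity (suc zero) = 0 , inj₂ refl
parity (suc (suc p)) with parity p
... | j , e = suc j , Sum.map (cong (2 +_)) (cong (2 +_)) e

*2≤1+*2⇒≤ : ∀ i k → i * 2 ≤ 1 + k * 2 → i ≤ k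
*2≤1+*2⇒≤ zero k _ = z≤n
*2≤1+*2⇒≤ (suc i) zero (s≤s ())
*2≤1+*2⇒≤ (suc i) (suc k) (s≤s (s≤s le)) = s≤s (*2≤1+*2⇒≤ i k le)

module _ {A : Set} where

  -- Indexed by j * 2 rather than 2 * j so that window suc j of f is definitionally
  -- window j of f ∘ (2 +_).
  InWindow : (ℕ → Maybe A) → ℕ → A → Set
  InWindow f j c = f (j * 2) ≡ just c ⊎ f (1 + j * 2) ≡ just c ⊎ f (2 + j * 2) ≡ just c

  _⊆ᵂ_ : (ℕ → Maybe A) → (ℕ → Maybe A) → Set
  f ⊆ᵂ g = ∀ j {c} → InWindow f j c → InWindow g j c

  InWindow-agree : ∀ {f g} j {c} → f (j * 2) ≡ g (j * 2) → f (1 + j * 2) ≡ g (1 + j * 2) →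
                   f (2 + j * 2) ≡ g (2 + j * 2) → InWindow f j c → InWindow g j c
  InWindow-agree _ e₀ e₁ e₂ = Sum.map (trans (sym e₀)) (Sum.map (trans (sym e₁)) (trans (sym e₂)))

  record BraidMoveAt (d : ℕ) (s t : A) (f g : ℕ → Maybe A) : Set where
    field
      prefix  : ∀ {p} → p ≤ d → f p ≡ g p
      source₁ : f (1 + d) ≡ just s
      source₂ : f (2 + d) ≡ just t
      source₃ : f (3 + d) ≡ just s
      target₁ : g (1 + d) ≡ just t
      target₂ : g (2 + d) ≡ just s
      target₃ : g (3 + d) ≡ just t
      suffix  : ∀ p → f (4 + d + p) ≡ g (4 + d + p)

  BraidMoveAt-shift : ∀ {d s t f g} → BraidMoveAt (2 + d) s t f g →
                      BraidMoveAt d s t (f ∘ (2 +_)) (g ∘ (2 +_))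
  BraidMoveAt-shift m = record { BraidMoveAt m hiding (prefix)
                               ; prefix = λ le → BraidMoveAt.prefix m (s≤s (s≤s le)) }

  module _ {s t : A} {f g : ℕ → Maybe A} (m : BraidMoveAt 0 s t f g) where
    open BraidMoveAt m

    private
      moved : ∀ {p p′ x c} → f p ≡ just x → g p′ ≡ just x → f p ≡ just c → g p′ ≡ just c
      moved fp gp′ e = trans gp′ (trans (sym fp) e)

    BraidMoveAt₀-⊆ᵂ : f ⊆ᵂ g
    BraidMoveAt₀-⊆ᵂ zero (inj₁ e) = inj₁ (trans (sym (prefix z≤n)) e)
    BraidMoveAt₀-⊆ᵂ zero (inj₂ (inj₁ e)) = inj₂ (inj₂ (moved source₁ target₂ e))
    BraidMoveAt₀-⊆ᵂ zero (inj₂ (inj₂ e)) = inj₂ (inj₁ (moved source₂ target₁ e))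
    BraidMoveAt₀-⊆ᵂ (suc zero) (inj₁ e) = inj₂ (inj₁ (moved source₂ target₃ e))
    BraidMoveAt₀-⊆ᵂ (suc zero) (inj₂ (inj₁ e)) = inj₁ (moved source₃ target₂ e)
    BraidMoveAt₀-⊆ᵂ (suc zero) (inj₂ (inj₂ e)) = inj₂ (inj₂ (trans (sym (suffix 0)) e))
    BraidMoveAt₀-⊆ᵂ (suc (suc j)) =
      InWindow-agree {f} {g} (suc (suc j)) (suffix (j * 2)) (suffix (1 + j * 2)) (suffix (2 + j * 2))

  BraidMoveAt-⊆ᵂ : ∀ q {s t f g} → BraidMoveAt (q * 2) s t f g → f ⊆ᵂ g
  BraidMoveAt-⊆ᵂ zero m = BraidMoveAt₀-⊆ᵂ m
  BraidMoveAt-⊆ᵂ (suc q) {f = f} {g = g} m zero =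
    InWindow-agree {f} {g} zero (prefix z≤n) (prefix (s≤s z≤n)) (prefix (s≤s (s≤s z≤n)))
    where open BraidMoveAt m
  BraidMoveAt-⊆ᵂ (suc q) m (suc j) = BraidMoveAt-⊆ᵂ q (BraidMoveAt-shift m) j

module _ {n : ℕ} (C : CoxeterSystem n) where
  open CoxeterSystem C

  letterAt-zero : ∀ w → letterAt C w 0 ≡ nothing
  letterAt-zero [] = refl
  letterAt-zero (_ ∷ _) = refl

  letterAt-beyond : ∀ w {p} → length w < p → letterAt C w p ≡ nothing
  letterAt-beyond [] _ = refl
  letterAt-beyond (_ ∷ _) {suc zero} (s≤s ())
  letterAt-beyond (_ ∷ w) {suc (suc p)} lt = letterAt-beyond w (≤-pred lt)

  letterAt-ext : ∀ {α β} → (∀ p → letterAt C α (suc p) ≡ letterAt C β (suc p)) → α ≡ β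
  letterAt-ext {[]} {[]} _ = refl
  letterAt-ext {[]} {_ ∷ _} agree with agree 0
  ... | ()
  letterAt-ext {_ ∷ _} {[]} agree with agree 0
  ... | ()
  letterAt-ext {x ∷ α} {y ∷ β} agree with agree 0
  ... | refl = cong (x ∷_) (letterAt-ext (agree ∘ suc))

  letterAt-square : ∀ w {p a} → letterAt C w p ≡ just a → letterAt C w (suc p) ≡ just a →
                    ∃₂ λ u v → w ≡ u ++ a ∷ a ∷ v
  letterAt-square (_ ∷ _ ∷ v) {suc zero} refl refl = [] , v , refl
  letterAt-square (x ∷ w) {suc (suc p)} e e′ with letterAt-square w e e′
  ... | u , v , refl = x ∷ u , v , refl

  reduced-no-square : ∀ u v a → ¬ Reduced C (u ++ a ∷ a ∷ v)
  reduced-no-square u v a red =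
    1+n≰n (≤-trans (n≤1+n _) (subst (_≤ length (u ++ v)) length-square (red (u ++ v) a²≈e)))
    where
    a²≈e : _≈W_ C (u ++ a ∷ a ∷ v) (u ++ v)
    a²≈e = ≈rel u v a a 1 (m-diag a)
    length-square : length (u ++ a ∷ a ∷ v) ≡ 2 + length (u ++ v)
    length-square = trans (length-++-sucʳ u a (a ∷ v)) (cong suc (length-++-sucʳ u a v))

  reduced-no-repeat : ∀ {w p a} → Reduced C w →
                      letterAt C w p ≡ just a → letterAt C w (suc p) ≡ just a → ⊥
  reduced-no-repeat {w} red e e′ with letterAt-square w e e′
  ... | u , v , refl = reduced-no-square u v _ red

  BraidMoveAt-cons : ∀ {d s t w w′} a → BraidMoveAt d s t (letterAt C w) (letterAt C w′) →
                     BraidMoveAt (suc d) s t (letterAt C (a ∷ w)) (letterAt C (a ∷ w′))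
  BraidMoveAt-cons {d} {w = w} {w′ = w′} a m =
    record { BraidMoveAt m hiding (prefix) ; prefix = prefix-cons }
    where
    prefix-cons : ∀ {p} → p ≤ suc d → letterAt C (a ∷ w) p ≡ letterAt C (a ∷ w′) p
    prefix-cons {zero} _ = refl
    prefix-cons {suc zero} _ = refl
    prefix-cons {suc (suc p)} (s≤s le) = BraidMoveAt.prefix m le

  BraidMove-at : ∀ u v s t → BraidMoveAt (length u) s t (letterAt C (u ++ s ∷ t ∷ s ∷ v))
                                                         (letterAt C (u ++ t ∷ s ∷ t ∷ v))
  BraidMove-at [] v s t = record
    { prefix = λ { z≤n → refl }
    ; source₁ = refl ; source₂ = refl ; source₃ = refl
    ; target₁ = refl ; target₂ = refl ; target₃ = refl ; suffix = λ _ → refl }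
  BraidMove-at (a ∷ u) v s t = BraidMoveAt-cons a (BraidMove-at u v s t)

  BraidMove-sym : ∀ {w w′} → BraidMove C w w′ → BraidMove C w′ w
  BraidMove-sym (move u v s t m≡3) = move u v t s (trans (m-sym t s) m≡3)

  ∼B-sym : ∀ {α β} → _∼B_ C α β → _∼B_ C β α
  ∼B-sym = reverse BraidMove-sym

  ∼B-length : ∀ {α β} → _∼B_ C α β → length α ≡ length β
  ∼B-length ε = refl
  ∼B-length (move u v s t _ ◅ rest) = trans (trans (length-++ u) (sym (length-++ u))) (∼B-length rest)

  ∼B-short : ∀ {α β} → length α < 3 → _∼B_ C α β → α ≡ β
  ∼B-short _ ε = refl
  ∼B-short short (move u v s t _ ◅ _) =
    ⊥-elim (<⇒≱ short (≤-trans (s≤s (s≤s (s≤s z≤n))) (length-++-≤ʳ (s ∷ t ∷ s ∷ v) {u})))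

  OddShadows : Word C → Set
  OddShadows α = ∀ i → InBS C α i → Odd C i

  OddShadows-∼B : ∀ {α β} → OddShadows α → _∼B_ C α β → OddShadows β
  OddShadows-∼B odd α∼β i (γ , β∼γ , shadow) = odd i (γ , α∼β ◅◅ β∼γ , shadow)

  BraidMove-⊆ᵂ : ∀ u v s t q → length u ≡ q * 2 →
                letterAt C (u ++ s ∷ t ∷ s ∷ v) ⊆ᵂ letterAt C (u ++ t ∷ s ∷ t ∷ v)
  BraidMove-⊆ᵂ u v s t q even = BraidMoveAt-⊆ᵂ q (subst (λ d → BraidMoveAt d s t
    (letterAt C (u ++ s ∷ t ∷ s ∷ v)) (letterAt C (u ++ t ∷ s ∷ t ∷ v))) even (BraidMove-at u v s t))

  ∼B-⊆ᵂ : ∀ {α β} → OddShadows α → _∼B_ C α β → letterAt C α ⊆ᵂ letterAt C β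
  ∼B-⊆ᵂ odd ε _ = id
  ∼B-⊆ᵂ odd (step@(move u v s t m≡3) ◅ rest) =
    λ j → ∼B-⊆ᵂ (OddShadows-∼B odd (step ◅ ε)) rest j ∘ BraidMove-⊆ᵂ u v s t q length-u-even j
    where
    open BraidMoveAt (BraidMove-at u v s t) using (source₁; source₂; source₃)
    shadowOdd : Odd C (suc (length u))
    shadowOdd = odd (suc (length u)) (_ , ε , s , t , source₁ , source₂ , source₃ , m≡3)
    q : ℕ
    q = proj₁ shadowOdd
    length-u-even : length u ≡ q * 2
    length-u-even = trans (suc-injective (proj₂ shadowOdd)) (*-comm 2 q)

  oddLetter-transfer : ∀ {α β} → Reduced C α → letterAt C α ⊆ᵂ letterAt C β →
                       (∀ j → letterAt C α (j * 2) ≡ letterAt C β (j * 2)) →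
                       ∀ j {a} → letterAt C α (1 + j * 2) ≡ just a → letterAt C β (1 + j * 2) ≡ just a
  oddLetter-transfer {α} red α⊆β evens j eα with α⊆β j (inj₂ (inj₁ eα))
  ... | inj₁ eβ = ⊥-elim (reduced-no-repeat {α} red (trans (evens j) eβ) eα)
  ... | inj₂ (inj₁ eβ) = eβ
  ... | inj₂ (inj₂ eβ) = ⊥-elim (reduced-no-repeat {α} red eα (trans (evens (suc j)) eβ))

  oddLetters-agree : ∀ {α β} → Reduced C α → Reduced C β →
                     letterAt C α ⊆ᵂ letterAt C β → letterAt C β ⊆ᵂ letterAt C α →
                     (∀ j → letterAt C α (j * 2) ≡ letterAt C β (j * 2)) →
                     ∀ j → letterAt C α (1 + j * 2) ≡ letterAt C β (1 + j * 2)
  oddLetters-agree {α} {β} redα redβ α⊆β β⊆α evens j with letterAt C α (1 + j * 2) in eα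
  ... | just a = sym (oddLetter-transfer {α} {β} redα α⊆β evens j eα)
  ... | nothing with letterAt C β (1 + j * 2) in eβ
  ...   | nothing = refl
  ...   | just b with trans (sym eα) (oddLetter-transfer {β} {α} redβ β⊆α (sym ∘ evens) j eβ)
  ...     | ()

  letterAt-agree-beyond : ∀ α β {p} → length α ≡ length β → length α < p →
                          letterAt C α p ≡ letterAt C β p
  letterAt-agree-beyond α β α≡β α<p =
    trans (letterAt-beyond α α<p) (sym (letterAt-beyond β (subst (_< _) α≡β α<p)))

  evenLetters-determine : ∀ {α β} → Reduced C α → Reduced C β → OddShadows α → _∼B_ C α β →
                          (∀ i → i * 2 ≤ length α → letterAt C α (i * 2) ≡ letterAt C β (i * 2)) →
                          α ≡ β
  evenLetters-determine {α} {β} redα redβ odd α∼β within = letterAt-ext (letters ∘ suc)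
    where
    evens : ∀ i → letterAt C α (i * 2) ≡ letterAt C β (i * 2)
    evens i with i * 2 ≤? length α
    ... | yes inside = within i inside
    ... | no outside = letterAt-agree-beyond α β (∼B-length α∼β) (≰⇒> outside)
    odds : ∀ j → letterAt C α (1 + j * 2) ≡ letterAt C β (1 + j * 2)
    odds = oddLetters-agree redα redβ (∼B-⊆ᵂ odd α∼β)
                            (∼B-⊆ᵂ (OddShadows-∼B odd α∼β) (∼B-sym α∼β)) evens
    letters : ∀ p → letterAt C α p ≡ letterAt C β p
    letters p with parity p
    ... | j , inj₁ refl = evens j
    ... | j , inj₂ refl = odds j

  oddLink-rank≥ : ∀ {α k r} → length α ≡ 1 + k * 2 →
                  (∀ i → InBS C α i ⇔ (Odd C i × 2 + i ≤ length α)) → HasRank C α r → k ≤ r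
  oddLink-rank≥ {α} {k} len shadows (l , _ , length-l , l≡bs) =
    subst (k ≤_) length-l (∈-injection⇒≤ oddPosition oddPosition-injective oddPosition∈l)
    where
    oddPosition : Fin k → ℕ
    oddPosition i = 1 + toℕ i * 2
    oddPosition-injective : Injective _≡_ _≡_ oddPosition
    oddPosition-injective = toℕ-injective ∘ *-cancelʳ-≡ _ _ 2 ∘ suc-injective
    oddPosition∈l : ∀ i → oddPosition i ∈ l
    oddPosition∈l i = Equivalence.from (l≡bs (oddPosition i))
      (Equivalence.from (shadows (oddPosition i))
        ((toℕ i , cong suc (*-comm (toℕ i) 2)) ,
         subst (_ ≤_) (sym len) (s≤s (*-monoˡ-≤ 2 (toℕ<n i)))))

lemma5p6 : ∀ {n} (C : CoxeterSystem n) → SimplyLaced C → TriangleFree C →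
           ∀ (α β : Word C) (r : ℕ) → 1 ≤ r →
           IsLink C α → IsLink C β → HasRank C α r → HasRank C β r →
           _∼B_ C α β →
           (α ≡ β) ⇔ (∀ i → 1 ≤ i → i ≤ r → letterAt C α (2 * i) ≡ letterAt C β (2 * i))
lemma5p6 C _ _ α β r _ (_ , _ , inj₁ length≡1) _ _ _ α∼β =
  mk⇔ (λ { refl _ _ _ → refl }) (λ _ → ∼B-short C (subst (_< 3) (sym length≡1) (s≤s (s≤s z≤n))) α∼β)
lemma5p6 C _ _ α β r _ (redα , _ , inj₂ ((k , len) , shadows)) (redβ , _) rankα _ α∼β =
  mk⇔ (λ { refl _ _ _ → refl })
      (λ evens → evenLetters-determine C redα redβ oddShadows α∼β (within evens))
  where
  len′ : length α ≡ 1 + k * 2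
  len′ = trans len (cong suc (*-comm 2 k))
  oddShadows : OddShadows C α
  oddShadows i = proj₁ ∘ Equivalence.to (shadows i)
  within : (∀ i → 1 ≤ i → i ≤ r → letterAt C α (2 * i) ≡ letterAt C β (2 * i)) →
           ∀ i → i * 2 ≤ length α → letterAt C α (i * 2) ≡ letterAt C β (i * 2)
  within _ zero _ = trans (letterAt-zero C α) (sym (letterAt-zero C β))
  within evens (suc i) inside = subst (λ p → letterAt C α p ≡ letterAt C β p) (*-comm 2 (suc i))
    (evens (suc i) (s≤s z≤n)
      (≤-trans (*2≤1+*2⇒≤ (suc i) k (subst (_ ≤_) len′ inside)) (oddLink-rank≥ C len′ shadows rankα)))
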